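{- Let $n\ge 3$ be odd and put $M=(n-1)^{n-1}$. Suppose that for every integer $x\ge 1$ $$\sum_{j=0}^{\frac{n-1}{2}}(-1)^j\binom{n}{2j+1}S_{n,0}\big((n-1)^{2j}x\big)=\sum_{j=0}^{n-1}S_{n,j}(x).$$ Define, for integers $x\ge 0$, $\nu_n(x)$ by $$S_{n,0}(x)=\sum_{j=0}^{\frac{n-3}{2}}(-1)^{\frac{n-3}{2}-j}\binom{n}{2j+1}S_{n,0}\Big((n-1)^{2j}\Big\lfloor\frac{x}{M}\Big\rfloor\Big)+\nu_n(x).$$ Then the sequence $\big((-1)^{s_{n-1}(x)}\nu_n(x)\big)_{x\ge 0}$ is periodic with period $2n(n-1)^{n-1}$.
   Context: For an integer $b\ge 2$ and integer $r\ge 0$, $s_b(r)$ denotes the sum of the digits of $r$ in base $b$. For integers $n\ge 3$, $0\le j\le n-1$ and $x\ge 0$, define $$S_{n,j}(x)=\sum_{0\le r<x,\; r\equiv j \pmod n}(-1)^{s_{n-1}(r)}.$$ -}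

module Defs where

open import Data.Nat using (ℕ; zero; suc; _+_; _*_; _∸_; _^_; _/_; _%_; _≟_)
open import Data.Nat.Combinatorics using (_C_)
open import Data.Integer using (ℤ; +_; -_) renaming (_+_ to _+ℤ_; _-_ to _-ℤ_; _*_ to _*ℤ_)
open import Relation.Nullary using (yes; no)

sgn : ℕ → ℤ
sgn zero = + 1
sgn (suc m) = - sgn m

-- digit sum of r in base (suc (suc b')), with fuel (fuel r suffices)
digitSumAux : ℕ → ℕ → ℕ → ℕ
digitSumAux b' zero r = 0
digitSumAux b' (suc f) r = r % suc (suc b') + digitSumAux b' f (r / suc (suc b'))

-- s_b(r); the value for b < 2 is junk (never used)
s : ℕ → ℕ → ℕ
s (suc (suc b')) r = digitSumAux b' r r
s _ r = 0

-- r mod n (junk for n = 0, never used)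
modN : ℕ → ℕ → ℕ
modN zero r = r
modN (suc n') r = r % suc n'

-- floor division (junk for divisor 0, never used)
div : ℕ → ℕ → ℕ
div x zero = 0
div x (suc m) = x / suc m

-- S_{n,j}(x) = Σ_{0 ≤ r < x, r ≡ j (mod n)} (-1)^{s_{n-1}(r)}
S : ℕ → ℕ → ℕ → ℤ
S n j zero = + 0
S n j (suc r) with modN n r ≟ j
... | yes _ = S n j r +ℤ sgn (s (n ∸ 1) r)
... | no _  = S n j r

sumBelow : ℕ → (ℕ → ℤ) → ℤ
sumBelow zero f = + 0
sumBelow (suc m) f = sumBelow m f +ℤ f m

M : ℕ → ℕ
M n = (n ∸ 1) ^ (n ∸ 1)

hypLHS : ℕ → ℕ → ℤ
hypLHS n x = sumBelow (suc ((n ∸ 1) / 2)) (λ j →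
  sgn j *ℤ (+ (n C (2 * j + 1))) *ℤ S n 0 ((n ∸ 1) ^ (2 * j) * x))

hypRHS : ℕ → ℕ → ℤ
hypRHS n x = sumBelow n (λ j → S n j x)

ν : ℕ → ℕ → ℤ
ν n x = S n 0 x -ℤ sumBelow (suc ((n ∸ 3) / 2)) (λ j →
  sgn ((n ∸ 3) / 2 ∸ j) *ℤ (+ (n C (2 * j + 1))) *ℤ S n 0 ((n ∸ 1) ^ (2 * j) * div x (M n)))

module Submission where

-- Write n = 2m+3, b = n-1 = 2m+2 (so s_b is the digit sum in
-- base b) and M = b^b.  Since b² ≡ 1 (mod n) we have M ≡ 1 (mod n), and
-- base-b digit sums are additive across a block of b^b, so for t < M
--     S_{n,0}(qM + t) = S_{n,0}(qM) + (-1)^{s(q)} T(q,t),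
-- where T(q,t) = Σ_{r<t, q+r ≡ 0 (mod n)} (-1)^{s(r)} depends on q only mod n.
-- The right-hand side of the hypothesis is F(x) = Σ_{r<x} (-1)^{s(r)}, and its
-- top term (j = m+1) is -(-1)^m S_{n,0}(Mq); solving the hypothesis for it gives
--     (-1)^{s(qM+t)} ν_n(qM+t) = (-1)^{s(t)} (T(q,t) - (-1)^m G(q)),
-- with G(q) = (-1)^{s(q)} F(q).  As b is even, G(q) depends only on q mod 2.
-- Hence the signed sequence is periodic in q with period 2n, i.e. in x with
-- period 2nM.

open import Defs
open import Data.Nat
open import Data.Nat.Properties
open import Data.Nat.DivMod
open import Data.Nat.Combinatorics using (_C_; nCn≡1)
open import Data.Nat.Divisibility using (_∣_; divides)
open import Data.Nat.Tactic.RingSolver using (solve-∀)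
open import Data.Integer using (ℤ; +_; -_) renaming (_+_ to _+ℤ_; _*_ to _*ℤ_; _-_ to _-ℤ_)
import Data.Integer.Properties as ℤP
import Data.Integer.Tactic.RingSolver as ℤSolver
open import Data.Product using (Σ; _,_; proj₁; proj₂)
open import Data.Sum using (inj₁; inj₂)
open import Relation.Binary.PropositionalEquality
open import Relation.Nullary using (yes; no; contradiction)
open ≡-Reasoning

sgn-+ : ∀ a c → sgn (a + c) ≡ sgn a *ℤ sgn c
sgn-+ zero    c = sym (ℤP.*-identityˡ (sgn c))
sgn-+ (suc a) c = trans (cong -_ (sgn-+ a c)) (ℤP.neg-distribˡ-* (sgn a) (sgn c))

sgn-sq : ∀ a → sgn a *ℤ sgn a ≡ + 1
sgn-sq zero    = refl
sgn-sq (suc a) = trans (neg-sq (sgn a)) (sgn-sq a)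
  where
  neg-sq : ∀ (z : ℤ) → (- z) *ℤ (- z) ≡ z *ℤ z
  neg-sq = ℤSolver.solve-∀

sgn-∸ : ∀ {a j} → j ≤ a → sgn (a ∸ j) ≡ sgn a *ℤ sgn j
sgn-∸ {a} {j} j≤a = begin
  sgn (a ∸ j)                        ≡⟨ sym (ℤP.*-identityʳ _) ⟩
  sgn (a ∸ j) *ℤ + 1                 ≡⟨ cong (sgn (a ∸ j) *ℤ_) (sym (sgn-sq j)) ⟩
  sgn (a ∸ j) *ℤ (sgn j *ℤ sgn j)    ≡⟨ sym (ℤP.*-assoc (sgn (a ∸ j)) _ _) ⟩
  sgn (a ∸ j) *ℤ sgn j *ℤ sgn j      ≡⟨ cong (_*ℤ sgn j) (sym (sgn-+ (a ∸ j) j)) ⟩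
  sgn (a ∸ j + j) *ℤ sgn j           ≡⟨ cong (λ e → sgn e *ℤ sgn j) (m∸n+n≡m j≤a) ⟩
  sgn a *ℤ sgn j                     ∎

-- The algebra that eliminates the top term of the hypothesis:
-- if σ² = 1 then (A + B) - σL = B - σ(L - σA).
sign-cancel : ∀ (σ A B L : ℤ) → σ *ℤ σ ≡ + 1 →
              (A +ℤ B) -ℤ σ *ℤ L ≡ B -ℤ σ *ℤ (L +ℤ (- σ) *ℤ A)
sign-cancel σ A B L σ²≡1 = begin
  (A +ℤ B) -ℤ σ *ℤ L              ≡⟨ cong (λ u → (u +ℤ B) -ℤ σ *ℤ L) (sym (ℤP.*-identityˡ A)) ⟩
  (+ 1 *ℤ A +ℤ B) -ℤ σ *ℤ L       ≡⟨ cong (λ u → (u *ℤ A +ℤ B) -ℤ σ *ℤ L) (sym σ²≡1) ⟩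
  (σ *ℤ σ *ℤ A +ℤ B) -ℤ σ *ℤ L    ≡⟨ expand σ A B L ⟩
  B -ℤ σ *ℤ (L +ℤ (- σ) *ℤ A)     ∎
  where
  expand : ∀ (σ A B L : ℤ) → (σ *ℤ σ *ℤ A +ℤ B) -ℤ σ *ℤ L ≡ B -ℤ σ *ℤ (L +ℤ (- σ) *ℤ A)
  expand = ℤSolver.solve-∀

sumBelow-cong : ∀ L {f g : ℕ → ℤ} → (∀ j → j < L → f j ≡ g j) → sumBelow L f ≡ sumBelow L g
sumBelow-cong zero    f≡g = refl
sumBelow-cong (suc L) f≡g =
  cong₂ _+ℤ_ (sumBelow-cong L (λ j j<L → f≡g j (≤-trans j<L (n≤1+n L)))) (f≡g L ≤-refl)

sumBelow-zero : ∀ L → sumBelow L (λ _ → + 0) ≡ + 0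
sumBelow-zero zero    = refl
sumBelow-zero (suc L) = cong (_+ℤ + 0) (sumBelow-zero L)

sumBelow-+ : ∀ L (f g : ℕ → ℤ) → sumBelow L (λ j → f j +ℤ g j) ≡ sumBelow L f +ℤ sumBelow L g
sumBelow-+ zero    f g = refl
sumBelow-+ (suc L) f g =
  trans (cong (_+ℤ (f L +ℤ g L)) (sumBelow-+ L f g)) (interchange (sumBelow L f) (sumBelow L g) (f L) (g L))
  where
  interchange : ∀ (a c d e : ℤ) → a +ℤ c +ℤ (d +ℤ e) ≡ a +ℤ d +ℤ (c +ℤ e)
  interchange = ℤSolver.solve-∀

sumBelow-*ˡ : ∀ L (a : ℤ) (f : ℕ → ℤ) → sumBelow L (λ j → a *ℤ f j) ≡ a *ℤ sumBelow L f
sumBelow-*ˡ zero    a f = sym (ℤP.*-zeroʳ a)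
sumBelow-*ˡ (suc L) a f =
  trans (cong (_+ℤ a *ℤ f L) (sumBelow-*ˡ L a f)) (sym (ℤP.*-distribˡ-+ a _ _))

sumBelow-split : ∀ a t (f : ℕ → ℤ) → sumBelow (a + t) f ≡ sumBelow a f +ℤ sumBelow t (λ r → f (a + r))
sumBelow-split a zero    f = trans (cong (λ u → sumBelow u f) (+-identityʳ a)) (sym (ℤP.+-identityʳ _))
sumBelow-split a (suc t) f = begin
  sumBelow (a + suc t) f                                       ≡⟨ cong (λ u → sumBelow u f) (+-suc a t) ⟩
  sumBelow (a + t) f +ℤ f (a + t)                              ≡⟨ cong (_+ℤ f (a + t)) (sumBelow-split a t f) ⟩
  sumBelow a f +ℤ sumBelow t (λ r → f (a + r)) +ℤ f (a + t)    ≡⟨ ℤP.+-assoc (sumBelow a f) _ _ ⟩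
  sumBelow a f +ℤ sumBelow (suc t) (λ r → f (a + r))           ∎

sumBelow-swap : ∀ L x (f : ℕ → ℕ → ℤ) →
                sumBelow L (λ j → sumBelow x (f j)) ≡ sumBelow x (λ r → sumBelow L (λ j → f j r))
sumBelow-swap L zero    f = sumBelow-zero L
sumBelow-swap L (suc x) f =
  trans (sumBelow-+ L (λ j → sumBelow x (f j)) (λ j → f j x)) (cong (_+ℤ sumBelow L (λ j → f j x)) (sumBelow-swap L x f))

δ : ℕ → ℕ → ℤ → ℤ
δ c j z with c ≟ j
... | yes _ = z
... | no  _ = + 0

δ-* : ∀ c j a z → δ c j (a *ℤ z) ≡ a *ℤ δ c j z
δ-* c j a z with c ≟ j
... | yes _ = refl
... | no  _ = sym (ℤP.*-zeroʳ a)

δ-≢ : ∀ {c j} z → c ≢ j → δ c j z ≡ + 0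
δ-≢ {c} {j} z c≢j with c ≟ j
... | yes c≡j = contradiction c≡j c≢j
... | no  _   = refl

δ-refl : ∀ c z → δ c c z ≡ z
δ-refl c z with c ≟ c
... | yes _   = refl
... | no  c≢c = contradiction refl c≢c

sumBelow-δ : ∀ {L c} z → c < L → sumBelow L (λ j → δ c j z) ≡ z
sumBelow-δ {suc L} {c} z c<1+L with m≤n⇒m<n∨m≡n (≤-pred c<1+L)
... | inj₁ c<L  = trans (cong₂ _+ℤ_ (sumBelow-δ z c<L) (δ-≢ z (<⇒≢ c<L))) (ℤP.+-identityʳ z)
... | inj₂ refl = trans (cong₂ _+ℤ_ below (δ-refl L z)) (ℤP.+-identityˡ z)
  where
  below : sumBelow L (λ j → δ L j z) ≡ + 0
  below = trans (sumBelow-cong L (λ j j<L → δ-≢ z (λ L≡j → <⇒≢ j<L (sym L≡j)))) (sumBelow-zero L)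

/-block : ∀ {d} .{{_ : NonZero d}} t q → t < d → (t + q * d) / d ≡ q
/-block {d} t q t<d = trans (+-distrib-/-∣ʳ t (divides q refl)) (cong₂ _+_ (m<n⇒m/n≡0 t<d) (m*n/n≡m q d))

div-block : ∀ d t q → t < d → div (t + q * d) d ≡ q
div-block (suc d) t q t<d = /-block t q t<d

pow-≡1 : ∀ {a n} K → a ≡ 1 + K * n → ∀ c → Σ ℕ λ K′ → a ^ c ≡ 1 + K′ * n
pow-≡1 K a≡ zero = 0 , refl
pow-≡1 {a} {n} K a≡ (suc c) with pow-≡1 K a≡ c
... | K′ , aᶜ≡ = K + K′ + K * n * K′ , trans (cong₂ _*_ a≡ aᶜ≡) (product K n K′)
  where
  product : ∀ K n K′ → (1 + K * n) * (1 + K′ * n) ≡ 1 + (K + K′ + K * n * K′) * n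
  product = solve-∀

-- Digit sums in base b = k + 2.  The base is written as suc (suc k), so that
-- s b unfolds to the fuelled recursion digitSumAux k.
module Digits (k : ℕ) where

  b : ℕ
  b = suc (suc k)

  digitSumAux-0 : ∀ f → digitSumAux k f 0 ≡ 0
  digitSumAux-0 zero    = refl
  digitSumAux-0 (suc f) = digitSumAux-0 f

  quotient-decreasing : ∀ r → suc r / b ≤ r
  quotient-decreasing r = ≤-pred (m/n<m (suc r) b (s≤s (s≤s z≤n)))

  fuel-irrelevant : ∀ f g r → r ≤ f → r ≤ g → digitSumAux k f r ≡ digitSumAux k g r
  fuel-irrelevant f       g       zero    _         _         = trans (digitSumAux-0 f) (sym (digitSumAux-0 g))
  fuel-irrelevant (suc f) (suc g) (suc r) (s≤s r≤f) (s≤s r≤g) =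
    cong (λ u → suc r % b + u) (fuel-irrelevant f g (suc r / b) (≤-trans (quotient-decreasing r) r≤f) (≤-trans (quotient-decreasing r) r≤g))

  s-unfold : ∀ r → s b r ≡ r % b + s b (r / b)
  s-unfold zero    = refl
  s-unfold (suc r) = cong (λ u → suc r % b + u) (fuel-irrelevant r (suc r / b) (suc r / b) (quotient-decreasing r) ≤-refl)

  digit-step : ∀ d q → d < b → s b (d + q * b) ≡ d + s b q
  digit-step d q d<b = trans (s-unfold (d + q * b))
    (cong₂ (λ u v → u + s b v) (trans ([m+kn]%n≡m%n d q b) (m<n⇒m%n≡m d<b)) (/-block d q d<b))

  digit-concat : ∀ e t q → t < b ^ e → s b (t + q * b ^ e) ≡ s b t + s b q
  digit-concat zero    zero    q _ = cong (s b) (*-identityʳ q)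
  digit-concat zero    (suc t) q (s≤s ())
  digit-concat (suc e) t       q t<bᵉ⁺¹ = begin
    s b (t + q * b ^ suc e)            ≡⟨ cong (s b) regroup ⟩
    s b (t₀ + (t₁ + q * b ^ e) * b)    ≡⟨ digit-step t₀ (t₁ + q * b ^ e) (m%n<n t b) ⟩
    t₀ + s b (t₁ + q * b ^ e)          ≡⟨ cong (λ u → t₀ + u) (digit-concat e t₁ q t₁<bᵉ) ⟩
    t₀ + (s b t₁ + s b q)              ≡⟨ sym (+-assoc t₀ (s b t₁) (s b q)) ⟩
    (t₀ + s b t₁) + s b q              ≡⟨ cong (_+ s b q) (sym (digit-step t₀ t₁ (m%n<n t b))) ⟩
    s b (t₀ + t₁ * b) + s b q          ≡⟨ cong (λ u → s b u + s b q) (sym (m≡m%n+[m/n]*n t b)) ⟩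
    s b t + s b q                      ∎
    where
    t₀ = t % b
    t₁ = t / b
    t₁<bᵉ : t₁ < b ^ e
    t₁<bᵉ = m<n*o⇒m/o<n (subst (t <_) (*-comm b (b ^ e)) t<bᵉ⁺¹)
    shuffle : ∀ a c q d p → a + c * d + q * (d * p) ≡ a + (c + q * p) * d
    shuffle = solve-∀
    regroup : t + q * b ^ suc e ≡ t₀ + (t₁ + q * b ^ e) * b
    regroup = trans (cong (_+ q * b ^ suc e) (m≡m%n+[m/n]*n t b)) (shuffle t₀ t₁ q b (b ^ e))

module Counting (k : ℕ) where
  open Digits k public

  n : ℕ
  n = suc b

  S-step : ∀ j r → S n j (suc r) ≡ S n j r +ℤ δ (r % n) j (sgn (s b r))
  S-step j r with r % n ≟ j
  ... | yes _ = refl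
  ... | no  _ = sym (ℤP.+-identityʳ _)

  S-as-sum : ∀ j x → S n j x ≡ sumBelow x (λ r → δ (r % n) j (sgn (s b r)))
  S-as-sum j zero    = refl
  S-as-sum j (suc x) = trans (S-step j x) (cong (_+ℤ δ (x % n) j (sgn (s b x))) (S-as-sum j x))

  F : ℕ → ℤ
  F x = sumBelow x (λ r → sgn (s b r))

  -- The right-hand side of the hypothesis is F: the residue classes partition [0, x).
  hypRHS≡F : ∀ x → hypRHS n x ≡ F x
  hypRHS≡F x = begin
    sumBelow n (λ j → S n j x)
      ≡⟨ sumBelow-cong n (λ j _ → S-as-sum j x) ⟩
    sumBelow n (λ j → sumBelow x (λ r → δ (r % n) j (sgn (s b r))))
      ≡⟨ sumBelow-swap n x (λ j r → δ (r % n) j (sgn (s b r))) ⟩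
    sumBelow x (λ r → sumBelow n (λ j → δ (r % n) j (sgn (s b r))))
      ≡⟨ sumBelow-cong x (λ r _ → sumBelow-δ (sgn (s b r)) (m%n<n r n)) ⟩
    F x ∎

  -- T q t = Σ_{r<t, q+r ≡ 0 (mod n)} (-1)^{s(r)}: the contribution of a block
  -- starting at a multiple of bᵉ ≡ 1 (mod n), with the block's top digits q removed.
  T : ℕ → ℕ → ℤ
  T q t = sumBelow t (λ r → δ ((q + r) % n) 0 (sgn (s b r)))

  T-periodic : ∀ c q t → T (q + c * n) t ≡ T q t
  T-periodic c q t = sumBelow-cong t (λ r _ → cong (λ u → δ u 0 (sgn (s b r))) residue)
    where
    shuffle : ∀ q c n r → q + c * n + r ≡ q + r + c * n
    shuffle = solve-∀
    residue : ∀ {r} → (q + c * n + r) % n ≡ (q + r) % n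
    residue {r} = trans (cong (_% n) (shuffle q c n r)) ([m+kn]%n≡m%n (q + r) c n)

  S-block : ∀ e K → b ^ e ≡ 1 + K * n → ∀ q t → t ≤ b ^ e →
            S n 0 (q * b ^ e + t) ≡ S n 0 (q * b ^ e) +ℤ sgn (s b q) *ℤ T q t
  S-block e K bᵉ≡ q t t≤bᵉ = begin
    S n 0 (q * b ^ e + t)
      ≡⟨ S-as-sum 0 (q * b ^ e + t) ⟩
    sumBelow (q * b ^ e + t) summand
      ≡⟨ sumBelow-split (q * b ^ e) t summand ⟩
    sumBelow (q * b ^ e) summand +ℤ sumBelow t (λ r → summand (q * b ^ e + r))
      ≡⟨ cong₂ _+ℤ_ (sym (S-as-sum 0 (q * b ^ e))) (sumBelow-cong t shifted) ⟩
    S n 0 (q * b ^ e) +ℤ sumBelow t (λ r → sgn (s b q) *ℤ δ ((q + r) % n) 0 (sgn (s b r)))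
      ≡⟨ cong (S n 0 (q * b ^ e) +ℤ_) (sumBelow-*ˡ t (sgn (s b q)) _) ⟩
    S n 0 (q * b ^ e) +ℤ sgn (s b q) *ℤ T q t ∎
    where
    summand : ℕ → ℤ
    summand r = δ (r % n) 0 (sgn (s b r))
    shuffle : ∀ q K n r → q * (1 + K * n) + r ≡ q + r + (q * K) * n
    shuffle = solve-∀
    residue : ∀ r → (q * b ^ e + r) % n ≡ (q + r) % n
    residue r = trans (cong (λ u → (q * u + r) % n) bᵉ≡)
                      (trans (cong (_% n) (shuffle q K n r)) ([m+kn]%n≡m%n (q + r) (q * K) n))
    sign : ∀ r → r < b ^ e → sgn (s b (q * b ^ e + r)) ≡ sgn (s b q) *ℤ sgn (s b r)
    sign r r<bᵉ = begin
      sgn (s b (q * b ^ e + r))       ≡⟨ cong (λ u → sgn (s b u)) (+-comm (q * b ^ e) r) ⟩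
      sgn (s b (r + q * b ^ e))       ≡⟨ cong sgn (digit-concat e r q r<bᵉ) ⟩
      sgn (s b r + s b q)             ≡⟨ sgn-+ (s b r) (s b q) ⟩
      sgn (s b r) *ℤ sgn (s b q)      ≡⟨ ℤP.*-comm (sgn (s b r)) _ ⟩
      sgn (s b q) *ℤ sgn (s b r)      ∎
    shifted : ∀ r → r < t → summand (q * b ^ e + r) ≡ sgn (s b q) *ℤ δ ((q + r) % n) 0 (sgn (s b r))
    shifted r r<t = trans (cong₂ (λ u v → δ u 0 v) (residue r) (sign r (≤-trans r<t t≤bᵉ)))
                          (δ-* ((q + r) % n) 0 (sgn (s b q)) (sgn (s b r)))

  A : ℕ → ℤ
  A d = sumBelow d sgn

  A-even : ∀ c → A (c * 2) ≡ + 0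
  A-even zero    = refl
  A-even (suc c) = trans (cancel (A (c * 2)) (sgn (c * 2))) (A-even c)
    where
    cancel : ∀ (a z : ℤ) → a +ℤ z +ℤ (- z) ≡ a
    cancel = ℤSolver.solve-∀

  F-block : ∀ q d → d ≤ b → F (q * b + d) ≡ F (q * b) +ℤ sgn (s b q) *ℤ A d
  F-block q d d≤b = begin
    F (q * b + d)
      ≡⟨ sumBelow-split (q * b) d (λ r → sgn (s b r)) ⟩
    F (q * b) +ℤ sumBelow d (λ r → sgn (s b (q * b + r)))
      ≡⟨ cong (F (q * b) +ℤ_) (sumBelow-cong d sign) ⟩
    F (q * b) +ℤ sumBelow d (λ r → sgn (s b q) *ℤ sgn r)
      ≡⟨ cong (F (q * b) +ℤ_) (sumBelow-*ˡ d (sgn (s b q)) sgn) ⟩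
    F (q * b) +ℤ sgn (s b q) *ℤ A d ∎
    where
    sign : ∀ r → r < d → sgn (s b (q * b + r)) ≡ sgn (s b q) *ℤ sgn r
    sign r r<d = begin
      sgn (s b (q * b + r))     ≡⟨ cong (λ u → sgn (s b u)) (+-comm (q * b) r) ⟩
      sgn (s b (r + q * b))     ≡⟨ cong sgn (digit-step r q (≤-trans r<d d≤b)) ⟩
      sgn (r + s b q)           ≡⟨ sgn-+ r (s b q) ⟩
      sgn r *ℤ sgn (s b q)      ≡⟨ ℤP.*-comm (sgn r) _ ⟩
      sgn (s b q) *ℤ sgn r      ∎

  F-multiple : 2 ∣ b → ∀ q → F (q * b) ≡ + 0
  F-multiple 2∣b zero    = refl
  F-multiple 2∣b@(divides c b≡) (suc q) = begin
    F (b + q * b)                          ≡⟨ cong F (+-comm b (q * b)) ⟩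
    F (q * b + b)                          ≡⟨ F-block q b ≤-refl ⟩
    F (q * b) +ℤ sgn (s b q) *ℤ A b        ≡⟨ cong₂ (λ u v → u +ℤ sgn (s b q) *ℤ v) (F-multiple 2∣b q) (trans (cong A b≡) (A-even c)) ⟩
    + 0 +ℤ sgn (s b q) *ℤ + 0              ≡⟨ cong (+ 0 +ℤ_) (ℤP.*-zeroʳ (sgn (s b q))) ⟩
    + 0                                    ∎

  -- G q = (-1)^{s(q)} F q, the combination in which F enters the final formula.
  G : ℕ → ℤ
  G q = sgn (s b q) *ℤ F q

  -- H d = (-1)^d A d, the value of G on the last digit d.
  H : ℕ → ℤ
  H d = sgn d *ℤ A d

  G-last-digit : 2 ∣ b → ∀ q → G q ≡ H (q % b)
  G-last-digit 2∣b q = begin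
    G q                                                   ≡⟨ cong G q≡ ⟩
    G (q′ * b + d)                                        ≡⟨ cong₂ _*ℤ_ sign count ⟩
    (sgn d *ℤ sgn (s b q′)) *ℤ (sgn (s b q′) *ℤ A d)      ≡⟨ regroup (sgn d) (sgn (s b q′)) (A d) ⟩
    sgn d *ℤ A d *ℤ (sgn (s b q′) *ℤ sgn (s b q′))        ≡⟨ cong (sgn d *ℤ A d *ℤ_) (sgn-sq (s b q′)) ⟩
    sgn d *ℤ A d *ℤ + 1                                   ≡⟨ ℤP.*-identityʳ (H d) ⟩
    H d                                                   ∎
    where
    d  = q % b
    q′ = q / b
    q≡ : q ≡ q′ * b + d
    q≡ = trans (m≡m%n+[m/n]*n q b) (+-comm d (q′ * b))
    sign : sgn (s b (q′ * b + d)) ≡ sgn d *ℤ sgn (s b q′)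
    sign = trans (cong (λ u → sgn (s b u)) (+-comm (q′ * b) d))
                 (trans (cong sgn (digit-step d q′ (m%n<n q b))) (sgn-+ d (s b q′)))
    count : F (q′ * b + d) ≡ sgn (s b q′) *ℤ A d
    count = trans (F-block q′ d (<⇒≤ (m%n<n q b)))
                  (trans (cong (_+ℤ sgn (s b q′) *ℤ A d) (F-multiple 2∣b q′)) (ℤP.+-identityˡ _))
    regroup : ∀ (a g c : ℤ) → (a *ℤ g) *ℤ (g *ℤ c) ≡ a *ℤ c *ℤ (g *ℤ g)
    regroup = ℤSolver.solve-∀

  H-parity : ∀ d → H d ≡ H (d % 2)
  H-parity zero          = refl
  H-parity (suc zero)    = refl
  H-parity (suc (suc d)) = begin
    H (suc (suc d))     ≡⟨ period2 (sgn d) (A d) ⟩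
    H d                 ≡⟨ H-parity d ⟩
    H (d % 2)           ≡⟨ cong H (sym (trans (cong (_% 2) (+-comm 2 d)) ([m+n]%n≡m%n d 2))) ⟩
    H ((2 + d) % 2)     ∎
    where
    period2 : ∀ (z a : ℤ) → (- - z) *ℤ (a +ℤ z +ℤ - z) ≡ z *ℤ a
    period2 = ℤSolver.solve-∀

  G-periodic : 2 ∣ b → ∀ c q → G (q + 2 * c) ≡ G q
  G-periodic 2∣b c q = begin
    G (q + 2 * c)            ≡⟨ G-parity (q + 2 * c) ⟩
    H ((q + 2 * c) % 2)      ≡⟨ cong H (%-remove-+ʳ q (divides c (*-comm 2 c))) ⟩
    H (q % 2)                ≡⟨ sym (G-parity q) ⟩
    G q                      ∎
    where
    G-parity : ∀ q → G q ≡ H (q % 2)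
    G-parity q = trans (G-last-digit 2∣b q) (trans (H-parity (q % b)) (cong H (m∣n⇒o%n%m≡o%m 2 b q 2∣b)))

module OddModulus (m : ℕ) where
  open Counting (2 * m)

  b≡ : b ≡ 2 * suc m
  b≡ = sym (*-suc 2 m)

  b-even : 2 ∣ b
  b-even = divides (suc m) (trans b≡ (*-comm 2 (suc m)))

  instance
    M-nonZero : NonZero (M n)
    M-nonZero = m^n≢0 b b

  -- M n = b^b = (b²)^(m+1), and b² = 1 + (2m+1) n, so M n ≡ 1 (mod n).
  M≡1 : Σ ℕ λ K → M n ≡ 1 + K * n
  M≡1 = let (K , b²ᵐ⁺¹≡) = pow-≡1 {b ^ 2} {n} (suc (2 * m)) (square (2 * m)) (suc m)
        in K , trans M≡b²ᵐ⁺¹ b²ᵐ⁺¹≡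
    where
    square : ∀ k → (2 + k) * ((2 + k) * 1) ≡ 1 + (1 + k) * (3 + k)
    square = solve-∀
    M≡b²ᵐ⁺¹ : M n ≡ (b ^ 2) ^ suc m
    M≡b²ᵐ⁺¹ = trans (cong (b ^_) b≡) (sym (^-*-assoc b 2 (suc m)))

  binom : ℕ → ℤ
  binom j = + (n C (2 * j + 1))

  -- The hypothesis' left-hand side without its top term j = m + 1.
  L : ℕ → ℤ
  L q = sumBelow (suc m) (λ j → sgn j *ℤ binom j *ℤ S n 0 (b ^ (2 * j) * q))

  -- The top term has binomial weight n C n = 1 and argument b^b q = M n q.
  hypLHS-top : ∀ q → hypLHS n q ≡ L q +ℤ (- sgn m) *ℤ S n 0 (q * M n)
  hypLHS-top q = begin
    hypLHS n q
      ≡⟨ cong (λ h → sumBelow (suc h) (λ j → sgn j *ℤ binom j *ℤ S n 0 (b ^ (2 * j) * q))) half ⟩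
    L q +ℤ sgn (suc m) *ℤ binom (suc m) *ℤ S n 0 (b ^ (2 * suc m) * q)
      ≡⟨ cong (L q +ℤ_) (cong₂ (λ c y → (- sgn m) *ℤ + c *ℤ S n 0 y) weight argument) ⟩
    L q +ℤ (- sgn m) *ℤ + 1 *ℤ S n 0 (q * M n)
      ≡⟨ cong (λ z → L q +ℤ z *ℤ S n 0 (q * M n)) (ℤP.*-identityʳ (- sgn m)) ⟩
    L q +ℤ (- sgn m) *ℤ S n 0 (q * M n) ∎
    where
    half : b / 2 ≡ suc m
    half = trans (cong (_/ 2) (trans b≡ (*-comm 2 (suc m)))) (m*n/n≡m (suc m) 2)
    top-index : ∀ m → 2 * suc m + 1 ≡ 3 + 2 * m
    top-index = solve-∀
    weight : n C (2 * suc m + 1) ≡ 1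
    weight = trans (cong (n C_) (top-index m)) (nCn≡1 n)
    argument : b ^ (2 * suc m) * q ≡ q * M n
    argument = trans (cong (λ e → b ^ e * q) (sym b≡)) (*-comm (M n) q)

  -- The subtracted sum in ν is (-1)^m L, since (-1)^{m-j} = (-1)^m (-1)^j.
  ν-sum : ∀ q → sumBelow (suc m) (λ j → sgn (m ∸ j) *ℤ binom j *ℤ S n 0 (b ^ (2 * j) * q)) ≡ sgn m *ℤ L q
  ν-sum q = trans (sumBelow-cong (suc m) factor) (sumBelow-*ˡ (suc m) (sgn m) _)
    where
    reassoc : ∀ (a c d e : ℤ) → a *ℤ c *ℤ d *ℤ e ≡ a *ℤ (c *ℤ d *ℤ e)
    reassoc = ℤSolver.solve-∀
    factor : ∀ j → j < suc m → sgn (m ∸ j) *ℤ binom j *ℤ S n 0 (b ^ (2 * j) * q)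
                             ≡ sgn m *ℤ (sgn j *ℤ binom j *ℤ S n 0 (b ^ (2 * j) * q))
    factor j j<1+m = trans (cong (λ z → z *ℤ binom j *ℤ S n 0 (b ^ (2 * j) * q)) (sgn-∸ (≤-pred j<1+m)))
                           (reassoc (sgn m) (sgn j) (binom j) _)

  Hypothesis : Set
  Hypothesis = (x : ℕ) → 1 ≤ x → hypLHS n x ≡ hypRHS n x

  signed-ν : ℕ → ℤ
  signed-ν x = sgn (s b x) *ℤ ν n x

  module _ (hyp : Hypothesis) where

    -- The hypothesis reads hypLHS = F for all q (trivially for q = 0).
    hyp-F : ∀ q → hypLHS n q ≡ F q
    hyp-F zero    = trans (sumBelow-cong (suc (b / 2)) vanish) (sumBelow-zero (suc (b / 2)))
      where
      vanish : ∀ j → j < suc (b / 2) → sgn j *ℤ binom j *ℤ S n 0 (b ^ (2 * j) * 0) ≡ + 0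
      vanish j _ = trans (cong (λ y → sgn j *ℤ binom j *ℤ S n 0 y) (*-zeroʳ (b ^ (2 * j))))
                         (ℤP.*-zeroʳ (sgn j *ℤ binom j))
    hyp-F (suc q) = trans (hyp (suc q) (s≤s z≤n)) (hypRHS≡F (suc q))

    -- ν on the block of q: the S(M q) terms cancel by the hypothesis.
    ν-block : ∀ q t → t < M n → ν n (t + q * M n) ≡ sgn (s b q) *ℤ T q t -ℤ sgn m *ℤ F q
    ν-block q t t<M = begin
      ν n (t + q * M n)
        ≡⟨ cong₂ (λ h d → S n 0 (t + q * M n) -ℤ sumBelow (suc h) (λ j → sgn (h ∸ j) *ℤ binom j *ℤ S n 0 (b ^ (2 * j) * d)))
                 half (div-block (M n) t q t<M) ⟩
      S n 0 (t + q * M n) -ℤ sumBelow (suc m) (λ j → sgn (m ∸ j) *ℤ binom j *ℤ S n 0 (b ^ (2 * j) * q))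
        ≡⟨ cong₂ _-ℤ_ S-split (ν-sum q) ⟩
      (S n 0 (q * M n) +ℤ sgn (s b q) *ℤ T q t) -ℤ sgn m *ℤ L q
        ≡⟨ sign-cancel (sgn m) (S n 0 (q * M n)) (sgn (s b q) *ℤ T q t) (L q) (sgn-sq m) ⟩
      sgn (s b q) *ℤ T q t -ℤ sgn m *ℤ (L q +ℤ (- sgn m) *ℤ S n 0 (q * M n))
        ≡⟨ cong (λ z → sgn (s b q) *ℤ T q t -ℤ sgn m *ℤ z) (trans (sym (hypLHS-top q)) (hyp-F q)) ⟩
      sgn (s b q) *ℤ T q t -ℤ sgn m *ℤ F q ∎
      where
      half : (2 * m) / 2 ≡ m
      half = trans (cong (_/ 2) (*-comm 2 m)) (m*n/n≡m m 2)
      S-split : S n 0 (t + q * M n) ≡ S n 0 (q * M n) +ℤ sgn (s b q) *ℤ T q t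
      S-split = trans (cong (S n 0) (+-comm t (q * M n))) (S-block b (proj₁ M≡1) (proj₂ M≡1) q t (<⇒≤ t<M))

    -- Multiplying by the sign of x removes the dependence on the digits of q
    -- except through G q.
    signed-ν-block : ∀ q t → t < M n → signed-ν (t + q * M n) ≡ sgn (s b t) *ℤ (T q t -ℤ sgn m *ℤ G q)
    signed-ν-block q t t<M = begin
      signed-ν (t + q * M n)
        ≡⟨ cong₂ _*ℤ_ (trans (cong sgn (digit-concat b t q t<M)) (sgn-+ (s b t) (s b q))) (ν-block q t t<M) ⟩
      (σt *ℤ σq) *ℤ (σq *ℤ T q t -ℤ sgn m *ℤ F q)
        ≡⟨ regroup σt σq (T q t) (sgn m) (F q) ⟩
      σt *ℤ ((σq *ℤ σq) *ℤ T q t -ℤ sgn m *ℤ G q)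
        ≡⟨ cong (λ z → σt *ℤ (z *ℤ T q t -ℤ sgn m *ℤ G q)) (sgn-sq (s b q)) ⟩
      σt *ℤ (+ 1 *ℤ T q t -ℤ sgn m *ℤ G q)
        ≡⟨ cong (λ z → σt *ℤ (z -ℤ sgn m *ℤ G q)) (ℤP.*-identityˡ (T q t)) ⟩
      σt *ℤ (T q t -ℤ sgn m *ℤ G q) ∎
      where
      σt = sgn (s b t)
      σq = sgn (s b q)
      regroup : ∀ (a g c e f : ℤ) → (a *ℤ g) *ℤ (g *ℤ c -ℤ e *ℤ f) ≡ a *ℤ ((g *ℤ g) *ℤ c -ℤ e *ℤ (g *ℤ f))
      regroup = ℤSolver.solve-∀

    -- Shifting x by 2nM shifts q by 2n, which changes neither T q t nor G q.
    periodic : ∀ x → signed-ν (x + 2 * n * M n) ≡ signed-ν x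
    periodic x = begin
      signed-ν (x + 2 * n * M n)                         ≡⟨ cong signed-ν shifted ⟩
      signed-ν (t + (q + 2 * n) * M n)                   ≡⟨ signed-ν-block (q + 2 * n) t t<M ⟩
      sgn (s b t) *ℤ (T (q + 2 * n) t -ℤ sgn m *ℤ G (q + 2 * n))
        ≡⟨ cong₂ (λ u v → sgn (s b t) *ℤ (u -ℤ sgn m *ℤ v)) (T-periodic 2 q t) (G-periodic b-even n q) ⟩
      sgn (s b t) *ℤ (T q t -ℤ sgn m *ℤ G q)             ≡⟨ sym (signed-ν-block q t t<M) ⟩
      signed-ν (t + q * M n)                             ≡⟨ cong signed-ν (sym x≡) ⟩
      signed-ν x                                         ∎
      where
      t = x % M n
      q = x / M n
      t<M : t < M n
      t<M = m%n<n x (M n)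
      x≡ : x ≡ t + q * M n
      x≡ = m≡m%n+[m/n]*n x (M n)
      shift : ∀ t q n M → t + q * M + 2 * n * M ≡ t + (q + 2 * n) * M
      shift = solve-∀
      shifted : x + 2 * n * M n ≡ t + (q + 2 * n) * M n
      shifted = trans (cong (_+ 2 * n * M n) x≡) (shift t q n (M n))

odd-form : ∀ n → 3 ≤ n → n % 2 ≡ 1 → Σ ℕ λ m → n ≡ 3 + 2 * m
odd-form n 3≤n odd with n / 2 | m≡m%n+[m/n]*n n 2
... | zero  | n≡ = contradiction (subst (3 ≤_) (trans n≡ (cong (_+ 0) odd)) 3≤n) λ { (s≤s ()) }
... | suc m | n≡ = m , trans n≡ (trans (cong (_+ suc m * 2) odd) (rearrange m))
  where
  rearrange : ∀ m → 1 + (1 + m) * 2 ≡ 3 + 2 * m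
  rearrange = solve-∀

theorem8 : (n : ℕ) → 3 ≤ n → n % 2 ≡ 1 →
    ((x : ℕ) → 1 ≤ x → hypLHS n x ≡ hypRHS n x) →
    (x : ℕ) →
      sgn (s (n ∸ 1) (x + 2 * n * M n)) *ℤ ν n (x + 2 * n * M n)
        ≡ sgn (s (n ∸ 1) x) *ℤ ν n x
theorem8 n 3≤n odd hyp with odd-form n 3≤n odd
... | m , refl = OddModulus.periodic m hyp
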